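{- Let $D_1,D_2$ be $(2^n,2^n,2^n,1)$-relative difference sets in $\mathbb{Z}_4^n$ relative to $2\mathbb{Z}_4^n$ with $0\in D_1$ and $0\in D_2$, such that for $i=1,2$ the structure $(\mathbb{F}_2^n,+,*_{h_i})$ is a commutative presemifield, where $h_i$ is the $\mathbb{F}_2^n$-representation of $D_i$. If there exist $\alpha\in\mathrm{Aut}(\mathbb{Z}_4^n)$ and $g\in\mathbb{Z}_4^n$ with $\alpha(D_1)=D_2+g$, then there exists $\beta\in\mathrm{Aut}(\mathbb{Z}_4^n)$ with $\beta(D_1)=D_2$.
   Context: Relative difference set: a $k$-subset $D$ of a group $G$ of order $mn$ with subgroup $N$ of order $n$ such that each element of $G\setminus N$ is a difference of elements of $D$ in exactly $\lambda$ ways and no nonzero element of $N$ is. Let $\psi:\mathbb{F}_2\to\mathbb{Z}_4$ be $0\mapsto0,1\mapsto1$, $\Psi$ its coordinatewise extension, $\lfloor a,b\rfloor:=\Psi(a)+2\Psi(b)$. Such $D$ is a transversal of $2\mathbb{Z}_4^n$ and its elements are uniquely $\lfloor d,h(d)\rfloor$, $h:\mathbb{F}_2^n\to\mathbb{F}_2^n$ the $\mathbb{F}_2^n$-representation. $x\odot y=(x_iy_i)_i$, $x*_hy=h(x+y)+h(x)+h(y)+x\odot y$. A commutative presemifield: $*$ commutative, distributive over $+$, without zero divisors. -}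

module Defs where

open import Data.Bool using (Bool; true; false; _xor_; _∧_; if_then_else_)
open import Data.Nat using (ℕ; zero; suc; _^_)
open import Data.List using (List; []; _∷_; map; concatMap; length; filter)
open import Data.Nat.ListAction using (sum)
open import Data.Vec using (Vec; []; _∷_; zipWith; replicate)
import Data.Vec.Properties as VecP
open import Data.Product using (_×_; Σ; ∃; _,_)
open import Relation.Binary.PropositionalEquality using (_≡_; _≢_; refl)
open import Relation.Nullary using (¬_; Dec; yes; no)
open import Relation.Nullary.Decidable using (⌊_⌋)

data Z4 : Set where
  z0 z1 z2 z3 : Z4

_+₄_ : Z4 → Z4 → Z4
z0 +₄ y = y
z1 +₄ z0 = z1
z1 +₄ z1 = z2
z1 +₄ z2 = z3
z1 +₄ z3 = z0
z2 +₄ z0 = z2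
z2 +₄ z1 = z3
z2 +₄ z2 = z0
z2 +₄ z3 = z1
z3 +₄ z0 = z3
z3 +₄ z1 = z0
z3 +₄ z2 = z1
z3 +₄ z3 = z2

-₄_ : Z4 → Z4
-₄ z0 = z0
-₄ z1 = z3
-₄ z2 = z2
-₄ z3 = z1

_≟₄_ : (x y : Z4) → Dec (x ≡ y)
z0 ≟₄ z0 = yes refl
z0 ≟₄ z1 = no λ ()
z0 ≟₄ z2 = no λ ()
z0 ≟₄ z3 = no λ ()
z1 ≟₄ z0 = no λ ()
z1 ≟₄ z1 = yes refl
z1 ≟₄ z2 = no λ ()
z1 ≟₄ z3 = no λ ()
z2 ≟₄ z0 = no λ ()
z2 ≟₄ z1 = no λ ()
z2 ≟₄ z2 = yes refl
z2 ≟₄ z3 = no λ ()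
z3 ≟₄ z0 = no λ ()
z3 ≟₄ z1 = no λ ()
z3 ≟₄ z2 = no λ ()
z3 ≟₄ z3 = yes refl

Z4n : ℕ → Set
Z4n n = Vec Z4 n

_+ᵥ_ : ∀ {n} → Z4n n → Z4n n → Z4n n
_+ᵥ_ = zipWith _+₄_

_-ᵥ_ : ∀ {n} → Z4n n → Z4n n → Z4n n
x -ᵥ y = zipWith (λ a b → a +₄ (-₄ b)) x y

0ᵥ : ∀ {n} → Z4n n
0ᵥ = replicate _ z0

_≟ᵥ_ : ∀ {n} (x y : Z4n n) → Dec (x ≡ y)
_≟ᵥ_ = VecP.≡-dec _≟₄_

allZ4n : (n : ℕ) → List (Z4n n)
allZ4n zero = [] ∷ []
allZ4n (suc n) = concatMap (λ v → map (_∷ v) (z0 ∷ z1 ∷ z2 ∷ z3 ∷ [])) (allZ4n n)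

Subset : ℕ → Set
Subset n = Z4n n → Bool

_∈_ : ∀ {n} → Z4n n → Subset n → Set
z ∈ D = D z ≡ true

card : ∀ {n} → Subset n → ℕ
card {n} D = length (filter (λ z → D z Data.Bool.≟ true) (allZ4n n))
  where import Data.Bool

diffCount : ∀ {n} → Subset n → Z4n n → ℕ
diffCount {n} D g =
  sum (map (λ a → sum (map (λ b →
      if D a ∧ D b ∧ ⌊ (a -ᵥ b) ≟ᵥ g ⌋ then 1 else 0) (allZ4n n))) (allZ4n n))

data Even₄ : Z4 → Set where
  e0 : Even₄ z0
  e2 : Even₄ z2

data In2Z4n : ∀ {n} → Z4n n → Set where
  []  : In2Z4n []
  _∷_ : ∀ {n x} {v : Z4n n} → Even₄ x → In2Z4n v → In2Z4n (x ∷ v)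

IsRDS : (n : ℕ) → Subset n → Set
IsRDS n D =
  (card D ≡ 2 ^ n)
  × (∀ g → ¬ In2Z4n g → diffCount D g ≡ 1)
  × (∀ g → In2Z4n g → g ≢ 0ᵥ → diffCount D g ≡ 0)

F2n : ℕ → Set
F2n n = Vec Bool n

ψ : Bool → Z4
ψ false = z0
ψ true = z1

Ψ : ∀ {n} → F2n n → Z4n n
Ψ = Data.Vec.map ψ
  where import Data.Vec

floor2 : ∀ {n} → F2n n → F2n n → Z4n n
floor2 a b = Ψ a +ᵥ (Ψ b +ᵥ Ψ b)

-- h is the 𝔽₂ⁿ-representation of D: every element of D is uniquely ⌊d,h(d)⌋,
-- i.e. for each d, ⌊d,b⌋ ∈ D iff b = h(d)
IsF2Rep : ∀ {n} → Subset n → (F2n n → F2n n) → Set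
IsF2Rep {n} D h =
  (∀ d → floor2 d (h d) ∈ D)
  × (∀ d b → floor2 d b ∈ D → b ≡ h d)
  × (∀ z → z ∈ D → ∃ λ d → z ≡ floor2 d (h d))

_⊕_ : ∀ {n} → F2n n → F2n n → F2n n
_⊕_ = zipWith _xor_

_⊙_ : ∀ {n} → F2n n → F2n n → F2n n
_⊙_ = zipWith _∧_

0₂ : ∀ {n} → F2n n
0₂ = replicate _ false

mulH : ∀ {n} → (F2n n → F2n n) → F2n n → F2n n → F2n n
mulH h x y = h (x ⊕ y) ⊕ (h x ⊕ (h y ⊕ (x ⊙ y)))

IsCommPresemifield : (n : ℕ) → (F2n n → F2n n → F2n n) → Set
IsCommPresemifield n _*_ =
  (∀ x y → x * y ≡ y * x)
  × (∀ x y z → x * (y ⊕ z) ≡ (x * y) ⊕ (x * z))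
  × (∀ x y z → (x ⊕ y) * z ≡ (x * z) ⊕ (y * z))
  × (∀ x y → x * y ≡ 0₂ → (x ≡ 0₂) Data.Sum.⊎ (y ≡ 0₂))
  where import Data.Sum

IsAut : (n : ℕ) → (Z4n n → Z4n n) → Set
IsAut n α =
  (∀ x y → α (x +ᵥ y) ≡ α x +ᵥ α y)
  × (Σ (Z4n n → Z4n n) λ β → (∀ x → β (α x) ≡ x) × (∀ y → α (β y) ≡ y))

ImageIsTranslate : ∀ {n} → (Z4n n → Z4n n) → Subset n → Subset n → Z4n n → Set
ImageIsTranslate {n} α D₁ D₂ g =
  ∀ z → ((∃ λ y → y ∈ D₁ × α y ≡ z) → (z -ᵥ g) ∈ D₂)
      × ((z -ᵥ g) ∈ D₂ → ∃ λ y → y ∈ D₁ × α y ≡ z)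

-- Write every element of ℤ₄ⁿ as ⌊a,b⌋. In these coordinates addition is
-- ⌊a,b⌋ + ⌊d,e⌋ = ⌊a+d, b+e+a⊙d⌋, so for every additive L on 𝔽₂ⁿ the shear
-- ⌊a,b⌋ ↦ ⌊a, b+L(a)⌋ is an involutive automorphism of ℤ₄ⁿ. Since α(0) = 0 ∈ α(D₁),
-- −g lies in D₂, say −g = ⌊d,h₂(d)⌋. Then ⌊a,b⌋ − g ∈ D₂ means b = h₂(a+d) + h₂(d) + a⊙d,
-- i.e. b + a *_{h₂} d = h₂(a), which says that the shear by L(a) = a *_{h₂} d maps ⌊a,b⌋
-- into D₂. Right distributivity of *_{h₂} makes L additive, so β = shear_L ∘ α works.

module Submission where

open import Defs
open import Level using (0ℓ)
open import Algebra.Bundles using (AbelianGroup)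
open import Data.Bool using (Bool; true; false; _xor_; _∧_)
open import Data.Bool.Properties using (xor-assoc; xor-comm; xor-identityˡ; xor-identityʳ; xor-same)
open import Data.Nat using (ℕ)
open import Data.Product using (_×_; Σ; ∃; _,_; proj₁; proj₂)
open import Data.Vec using ([]; _∷_; map; head; tail)
open import Data.Vec.Properties using (zipWith-assoc; zipWith-comm; zipWith-identityˡ; zipWith-identityʳ)
open import Function using (_∘_; id; _⇔_; mk⇔; Equivalence)
open import Function.Properties.Equivalence using (⇔-setoid)
open import Relation.Binary.PropositionalEquality
  using (_≡_; refl; sym; trans; cong; cong₂; subst; module ≡-Reasoning)
open import Relation.Binary.PropositionalEquality.Algebra using (isMagma)

⊕-same : ∀ {n} (x : F2n n) → x ⊕ x ≡ 0₂
⊕-same [] = refl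
⊕-same (x ∷ xs) = cong₂ _∷_ (xor-same x) (⊕-same xs)

⊕-abelianGroup : ℕ → AbelianGroup 0ℓ 0ℓ
⊕-abelianGroup n = record
  { Carrier = F2n n
  ; _≈_ = _≡_
  ; _∙_ = _⊕_
  ; ε = 0₂
  ; _⁻¹ = id
  ; isAbelianGroup = record
    { isGroup = record
      { isMonoid = record
        { isSemigroup = record { isMagma = isMagma _⊕_ ; assoc = zipWith-assoc xor-assoc }
        ; identity = zipWith-identityˡ xor-identityˡ , zipWith-identityʳ xor-identityʳ
        }
      ; inverse = ⊕-same , ⊕-same
      ; ⁻¹-cong = id
      }
    ; comm = zipWith-comm xor-comm
    }
  }

module _ {n : ℕ} where
  open AbelianGroup (⊕-abelianGroup n) using (commutativeSemigroup)
  open import Algebra.Properties.AbelianGroup (⊕-abelianGroup n)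
    using (//-rightDividesʳ; \\-leftDividesʳ)
  open import Algebra.Properties.CommutativeSemigroup commutativeSemigroup
    using (interchange; x∙yz≈y∙xz; xy∙z≈xz∙y)

  ⊕-cancelʳ : ∀ (x y : F2n n) → (x ⊕ y) ⊕ y ≡ x
  ⊕-cancelʳ x y = //-rightDividesʳ y x

  ⊕-moveʳ : ∀ (x y z : F2n n) → x ⊕ y ≡ z ⇔ x ≡ z ⊕ y
  ⊕-moveʳ x y z = mk⇔ (λ e → trans (sym (⊕-cancelʳ x y)) (cong (_⊕ y) e))
                      (λ e → trans (cong (_⊕ y) e) (⊕-cancelʳ z y))

  ⊕-absorb : ∀ (p q c : F2n n) → q ⊕ (p ⊕ (q ⊕ c)) ≡ p ⊕ c
  ⊕-absorb p q c = trans (x∙yz≈y∙xz q p (q ⊕ c)) (cong (p ⊕_) (\\-leftDividesʳ q c))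

  ⊕-shuffle : ∀ (b e c l m : F2n n) → (b ⊕ (e ⊕ c)) ⊕ (l ⊕ m) ≡ (b ⊕ l) ⊕ ((e ⊕ m) ⊕ c)
  ⊕-shuffle b e c l m = trans (interchange b (e ⊕ c) l m) (cong ((b ⊕ l) ⊕_) (xy∙z≈xz∙y e c m))

bit₀ bit₁ : Z4 → Bool
bit₀ z0 = false
bit₀ z1 = true
bit₀ z2 = false
bit₀ z3 = true
bit₁ z0 = false
bit₁ z1 = false
bit₁ z2 = true
bit₁ z3 = true

digit₀ digit₁ : ∀ {n} → Z4n n → F2n n
digit₀ = map bit₀
digit₁ = map bit₁

floor2-digits : ∀ {n} (z : Z4n n) → floor2 (digit₀ z) (digit₁ z) ≡ z
floor2-digits [] = refl
floor2-digits (z0 ∷ z) = cong (z0 ∷_) (floor2-digits z)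
floor2-digits (z1 ∷ z) = cong (z1 ∷_) (floor2-digits z)
floor2-digits (z2 ∷ z) = cong (z2 ∷_) (floor2-digits z)
floor2-digits (z3 ∷ z) = cong (z3 ∷_) (floor2-digits z)

floor2-ind : ∀ {n} (P : Z4n n → Set) → (∀ a b → P (floor2 a b)) → ∀ z → P z
floor2-ind P P-floor2 z = subst P (floor2-digits z) (P-floor2 (digit₀ z) (digit₁ z))

digit₀-floor2 : ∀ {n} (a b : F2n n) → digit₀ (floor2 a b) ≡ a
digit₀-floor2 [] [] = refl
digit₀-floor2 (a ∷ as) (b ∷ bs) = cong₂ _∷_ (bit₀-ψ a b) (digit₀-floor2 as bs)
  where
  bit₀-ψ : ∀ a b → bit₀ (ψ a +₄ (ψ b +₄ ψ b)) ≡ a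
  bit₀-ψ false false = refl
  bit₀-ψ false true = refl
  bit₀-ψ true false = refl
  bit₀-ψ true true = refl

digit₁-floor2 : ∀ {n} (a b : F2n n) → digit₁ (floor2 a b) ≡ b
digit₁-floor2 [] [] = refl
digit₁-floor2 (a ∷ as) (b ∷ bs) = cong₂ _∷_ (bit₁-ψ a b) (digit₁-floor2 as bs)
  where
  bit₁-ψ : ∀ a b → bit₁ (ψ a +₄ (ψ b +₄ ψ b)) ≡ b
  bit₁-ψ false false = refl
  bit₁-ψ false true = refl
  bit₁-ψ true false = refl
  bit₁-ψ true true = refl

floor2-+ᵥ : ∀ {n} (a b d e : F2n n) →
            floor2 a b +ᵥ floor2 d e ≡ floor2 (a ⊕ d) (b ⊕ (e ⊕ (a ⊙ d)))
floor2-+ᵥ [] [] [] [] = refl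
floor2-+ᵥ (a ∷ as) (b ∷ bs) (d ∷ ds) (e ∷ es) = cong₂ _∷_ (carry a b d e) (floor2-+ᵥ as bs ds es)
  where
  carry : ∀ a b d e → (ψ a +₄ (ψ b +₄ ψ b)) +₄ (ψ d +₄ (ψ e +₄ ψ e))
        ≡ ψ (a xor d) +₄ (ψ (b xor (e xor (a ∧ d))) +₄ ψ (b xor (e xor (a ∧ d))))
  carry false false false false = refl
  carry false false false true = refl
  carry false false true false = refl
  carry false false true true = refl
  carry false true false false = refl
  carry false true false true = refl
  carry false true true false = refl
  carry false true true true = refl
  carry true false false false = refl
  carry true false false true = refl
  carry true false true false = refl
  carry true false true true = refl
  carry true true false false = refl
  carry true true false true = refl
  carry true true true false = refl
  carry true true true true = refl

shear : ∀ {n} → (F2n n → F2n n) → Z4n n → Z4n n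
shear L z = floor2 (digit₀ z) (digit₁ z ⊕ L (digit₀ z))

shear-floor2 : ∀ {n} (L : F2n n → F2n n) (a b : F2n n) → shear L (floor2 a b) ≡ floor2 a (b ⊕ L a)
shear-floor2 L a b rewrite digit₀-floor2 a b | digit₁-floor2 a b = refl

shear-involutive : ∀ {n} (L : F2n n → F2n n) (z : Z4n n) → shear L (shear L z) ≡ z
shear-involutive L = floor2-ind (λ z → shear L (shear L z) ≡ z) λ a b → begin
  shear L (shear L (floor2 a b))  ≡⟨ cong (shear L) (shear-floor2 L a b) ⟩
  shear L (floor2 a (b ⊕ L a))    ≡⟨ shear-floor2 L a (b ⊕ L a) ⟩
  floor2 a ((b ⊕ L a) ⊕ L a)      ≡⟨ cong (floor2 a) (⊕-cancelʳ b (L a)) ⟩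
  floor2 a b                      ∎
  where open ≡-Reasoning

shear-+ᵥ : ∀ {n} (L : F2n n → F2n n) → (∀ x y → L (x ⊕ y) ≡ L x ⊕ L y) →
           ∀ x y → shear L (x +ᵥ y) ≡ shear L x +ᵥ shear L y
shear-+ᵥ L L-⊕ = floor2-ind _ λ a b → floor2-ind _ λ d e → begin
  shear L (floor2 a b +ᵥ floor2 d e)
    ≡⟨ cong (shear L) (floor2-+ᵥ a b d e) ⟩
  shear L (floor2 (a ⊕ d) (b ⊕ (e ⊕ (a ⊙ d))))
    ≡⟨ shear-floor2 L (a ⊕ d) _ ⟩
  floor2 (a ⊕ d) ((b ⊕ (e ⊕ (a ⊙ d))) ⊕ L (a ⊕ d))
    ≡⟨ cong (λ l → floor2 (a ⊕ d) ((b ⊕ (e ⊕ (a ⊙ d))) ⊕ l)) (L-⊕ a d) ⟩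
  floor2 (a ⊕ d) ((b ⊕ (e ⊕ (a ⊙ d))) ⊕ (L a ⊕ L d))
    ≡⟨ cong (floor2 (a ⊕ d)) (⊕-shuffle b e (a ⊙ d) (L a) (L d)) ⟩
  floor2 (a ⊕ d) ((b ⊕ L a) ⊕ ((e ⊕ L d) ⊕ (a ⊙ d)))
    ≡⟨ floor2-+ᵥ a (b ⊕ L a) d (e ⊕ L d) ⟨
  floor2 a (b ⊕ L a) +ᵥ floor2 d (e ⊕ L d)
    ≡⟨ cong₂ _+ᵥ_ (shear-floor2 L a b) (shear-floor2 L d e) ⟨
  shear L (floor2 a b) +ᵥ shear L (floor2 d e)
    ∎
  where open ≡-Reasoning

-ᵥ-identityʳ : ∀ {n} (w : Z4n n) → w -ᵥ 0ᵥ ≡ w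
-ᵥ-identityʳ = zipWith-identityʳ +₄-identityʳ
  where
  +₄-identityʳ : ∀ x → x +₄ (-₄ z0) ≡ x
  +₄-identityʳ z0 = refl
  +₄-identityʳ z1 = refl
  +₄-identityʳ z2 = refl
  +₄-identityʳ z3 = refl

-ᵥ≡+ᵥ-negate : ∀ {n} (w g : Z4n n) → w -ᵥ g ≡ w +ᵥ (0ᵥ -ᵥ g)
-ᵥ≡+ᵥ-negate [] [] = refl
-ᵥ≡+ᵥ-negate (w ∷ ws) (g ∷ gs) = cong (_ ∷_) (-ᵥ≡+ᵥ-negate ws gs)

x≡x+ᵥx⇒x≡0ᵥ : ∀ {n} (x : Z4n n) → x ≡ x +ᵥ x → x ≡ 0ᵥ
x≡x+ᵥx⇒x≡0ᵥ [] _ = refl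
x≡x+ᵥx⇒x≡0ᵥ (x ∷ xs) e = cong₂ _∷_ (head-case x (cong head e)) (x≡x+ᵥx⇒x≡0ᵥ xs (cong tail e))
  where
  head-case : ∀ x → x ≡ x +₄ x → x ≡ z0
  head-case z0 _ = refl

additive⇒0ᵥ↦0ᵥ : ∀ {n} (f : Z4n n → Z4n n) → (∀ x y → f (x +ᵥ y) ≡ f x +ᵥ f y) → f 0ᵥ ≡ 0ᵥ
additive⇒0ᵥ↦0ᵥ f f-+ᵥ =
  x≡x+ᵥx⇒x≡0ᵥ (f 0ᵥ) (trans (cong f (sym (zipWith-identityˡ (λ _ → refl) 0ᵥ))) (f-+ᵥ 0ᵥ 0ᵥ))

IsAut-∘ : ∀ {n} {α β : Z4n n → Z4n n} → IsAut n α → IsAut n β → IsAut n (β ∘ α)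
IsAut-∘ {α = α} {β} (α-+ᵥ , α⁻¹ , α⁻¹∘α , α∘α⁻¹) (β-+ᵥ , β⁻¹ , β⁻¹∘β , β∘β⁻¹) =
  (λ x y → trans (cong β (α-+ᵥ x y)) (β-+ᵥ (α x) (α y))) ,
  α⁻¹ ∘ β⁻¹ ,
  (λ x → trans (cong α⁻¹ (β⁻¹∘β (α x))) (α⁻¹∘α x)) ,
  (λ y → trans (cong β (α∘α⁻¹ (β⁻¹ y))) (β∘β⁻¹ y))

involution⇒IsAut : ∀ {n} {f : Z4n n → Z4n n} →
                   (∀ x y → f (x +ᵥ y) ≡ f x +ᵥ f y) → (∀ z → f (f z) ≡ z) → IsAut n f
involution⇒IsAut {f = f} f-+ᵥ f∘f = f-+ᵥ , f , f∘f , f∘f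

floor2∈⇔≡h : ∀ {n} {D : Subset n} {h : F2n n → F2n n} → IsF2Rep D h → ∀ a b → floor2 a b ∈ D ⇔ b ≡ h a
floor2∈⇔≡h {D = D} (h-∈ , ∈-h , _) a b = mk⇔ (∈-h a b) (λ e → subst (λ b → floor2 a b ∈ D) (sym e) (h-∈ a))

translate⇔shear : ∀ {n} {D : Subset n} {h : F2n n → F2n n} → IsF2Rep D h → ∀ d w →
                  (w +ᵥ floor2 d (h d)) ∈ D ⇔ shear (λ a → mulH h a d) w ∈ D
translate⇔shear {D = D} {h} rep d = floor2-ind _ λ a b → begin
  (floor2 a b +ᵥ floor2 d (h d)) ∈ D  ≡⟨ cong (_∈ D) (floor2-+ᵥ a b d (h d)) ⟩
  floor2 (a ⊕ d) (b ⊕ c a) ∈ D        ≈⟨ floor2∈⇔≡h rep (a ⊕ d) _ ⟩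
  b ⊕ c a ≡ h (a ⊕ d)                 ≈⟨ ⊕-moveʳ b (c a) (h (a ⊕ d)) ⟩
  b ≡ h (a ⊕ d) ⊕ c a                 ≡⟨ cong (b ≡_) (⊕-absorb (h (a ⊕ d)) (h a) (c a)) ⟨
  b ≡ h a ⊕ L a                       ≈⟨ ⊕-moveʳ b (L a) (h a) ⟨
  b ⊕ L a ≡ h a                       ≈⟨ floor2∈⇔≡h rep a _ ⟨
  floor2 a (b ⊕ L a) ∈ D              ≡⟨ cong (_∈ D) (shear-floor2 L a b) ⟨
  shear L (floor2 a b) ∈ D            ∎
  where
  open import Relation.Binary.Reasoning.Setoid (⇔-setoid 0ℓ)
  L : F2n _ → F2n _
  L a = mulH h a d
  c : F2n _ → F2n _
  c a = h d ⊕ (a ⊙ d)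

untranslate : ∀ {n} {α : Z4n n → Z4n n} {D₁ D₂ : Subset n} {g : Z4n n} (β : Z4n n → Z4n n) →
              ImageIsTranslate α D₁ D₂ g → (∀ z → β (β z) ≡ z) →
              (∀ w → (w -ᵥ g) ∈ D₂ ⇔ β w ∈ D₂) → ImageIsTranslate (β ∘ α) D₁ D₂ 0ᵥ
untranslate {α = α} {D₁} {D₂} β α-img β∘β shift z = to , from
  where
  to : (∃ λ y → y ∈ D₁ × β (α y) ≡ z) → (z -ᵥ 0ᵥ) ∈ D₂
  to (y , y∈D₁ , βαy≡z) =
    subst (_∈ D₂) (trans βαy≡z (sym (-ᵥ-identityʳ z)))
      (Equivalence.to (shift (α y)) (proj₁ (α-img (α y)) (y , y∈D₁ , refl)))

  from : (z -ᵥ 0ᵥ) ∈ D₂ → ∃ λ y → y ∈ D₁ × β (α y) ≡ z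
  from z∈D₂ =
    let ββz∈D₂ = subst (_∈ D₂) (trans (-ᵥ-identityʳ z) (sym (β∘β z))) z∈D₂
        (y , y∈D₁ , αy≡βz) = proj₂ (α-img (β z)) (Equivalence.from (shift (β z)) ββz∈D₂)
    in y , y∈D₁ , trans (cong β αy≡βz) (β∘β z)

corollary3p2 : (n : ℕ) (D₁ D₂ : Subset n) (h₁ h₂ : F2n n → F2n n)
    → IsRDS n D₁ → IsRDS n D₂
    → 0ᵥ ∈ D₁ → 0ᵥ ∈ D₂
    → IsF2Rep D₁ h₁ → IsF2Rep D₂ h₂
    → IsCommPresemifield n (mulH h₁) → IsCommPresemifield n (mulH h₂)
    → Σ (Z4n n → Z4n n) (λ α → Σ (Z4n n) λ g → IsAut n α × ImageIsTranslate α D₁ D₂ g)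
    → Σ (Z4n n → Z4n n) (λ β → IsAut n β × ImageIsTranslate β D₁ D₂ 0ᵥ)
corollary3p2 n D₁ D₂ h₁ h₂ _ _ 0∈D₁ _ _ rep₂ _ (_ , _ , *-distribʳ-⊕ , _) (α , g , α-aut , α-img) =
  shear L ∘ α ,
  IsAut-∘ α-aut (involution⇒IsAut (shear-+ᵥ L L-⊕) (shear-involutive L)) ,
  untranslate {D₂ = D₂} {g} (shear L) α-img (shear-involutive L) shift
  where
  -g∈D₂ : (0ᵥ -ᵥ g) ∈ D₂
  -g∈D₂ = proj₁ (α-img 0ᵥ) (0ᵥ , 0∈D₁ , additive⇒0ᵥ↦0ᵥ α (proj₁ α-aut))

  d : F2n n
  d = proj₁ (proj₂ (proj₂ rep₂) _ -g∈D₂)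

  -g≡⌊d,h₂d⌋ : 0ᵥ -ᵥ g ≡ floor2 d (h₂ d)
  -g≡⌊d,h₂d⌋ = proj₂ (proj₂ (proj₂ rep₂) _ -g∈D₂)

  L : F2n n → F2n n
  L x = mulH h₂ x d

  L-⊕ : ∀ x y → L (x ⊕ y) ≡ L x ⊕ L y
  L-⊕ x y = *-distribʳ-⊕ x y d

  shift : ∀ w → (w -ᵥ g) ∈ D₂ ⇔ shear L w ∈ D₂
  shift w = subst (λ v → v ∈ D₂ ⇔ shear L w ∈ D₂)
                  (sym (trans (-ᵥ≡+ᵥ-negate w g) (cong (w +ᵥ_) -g≡⌊d,h₂d⌋)))
                  (translate⇔shear rep₂ d w)
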